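{- Let $G\subseteq K_n$ with $V(G)=V(K_n)$ be a graph with maximum degree at most $\Delta$, and let $C\ge 0$. Then in the Blocker-start $C$-BSFN game played on the edges of $K_n\setminus G$, Constructor can build a matching $M$ in $K_n\setminus G$ covering at least $n-\Delta-2-C$ vertices. Moreover, if $\Delta\le 1$, $C=0$ and $n$ is odd, then $M$ covers $n-1$ vertices, while if $\Delta\le 1$, $C=0$ and $n$ is even, then $M$ covers $n-2$ vertices.
   Context: The Blocker-start $C$-BSFN game on $K_n\setminus G$: Blocker and Constructor alternately claim previously unclaimed edges of $K_n$ not belonging to $G$, Blocker moving first. Blocker may claim any such edge. Before each Constructor move a family $\{F_v : v\in V(K_n)\}$ of vertex sets is given (arbitrarily, possibly changing from move to move) with $|F_v|\le C$ for all $v$ and $u\in F_v$ iff $v\in F_u$, and Constructor may not claim an edge $uv$ with $u\in F_v$. -}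

module Defs where

open import Data.Nat using (ℕ; zero; suc; _+_; _*_; _≤_)
open import Data.Bool using (Bool; true; false; if_then_else_)
open import Data.Fin using (Fin)
open import Data.List using (List; []; _∷_; map; length; concatMap)
open import Data.Nat.ListAction using (sum)
open import Data.List.Base using (allFin)
open import Data.List.Membership.Propositional using (_∈_)
open import Data.List.Relation.Unary.All using (All)
open import Data.List.Relation.Unary.Unique.Propositional using (Unique)
open import Data.Product using (Σ; _×_; _,_)
open import Data.Sum using (_⊎_)
open import Relation.Nullary using (¬_)
open import Relation.Binary.PropositionalEquality using (_≡_; _≢_)

Graph : ℕ → Set
Graph n = Fin n → Fin n → Bool

count : ∀ {n} → (Fin n → Bool) → ℕ
count {n} f = sum (map (λ u → if f u then 1 else 0) (allFin n))

Simple : ∀ {n} → Graph n → Set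
Simple {n} G = (∀ u v → G u v ≡ G v u) × (∀ v → G v v ≡ false)

MaxDeg≤ : ∀ {n} → Graph n → ℕ → Set
MaxDeg≤ {n} G Δ = ∀ (v : Fin n) → count (G v) ≤ Δ

-- Edges are recorded as ordered pairs; a pair (u , v) stands for the edge uv.
Edge : ℕ → Set
Edge n = Fin n × Fin n

Claimed : ∀ {n} → List (Edge n) → Fin n → Fin n → Set
Claimed L u v = ((u , v) ∈ L) ⊎ ((v , u) ∈ L)

Avail : ∀ {n} → Graph n → List (Edge n) → List (Edge n) → Edge n → Set
Avail G B Cn (u , v) =
  (u ≢ v) × (G u v ≡ false) × ¬ Claimed B u v × ¬ Claimed Cn u v

-- A valid forbidden family {F_v} for parameter C: F v u ≡ true means u ∈ F_v;
-- u ∈ F_v iff v ∈ F_u, and |F_v| ≤ C.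
ValidFamily : ℕ → ℕ → Set
ValidFamily n C =
  Σ (Fin n → Fin n → Bool) λ F →
    (∀ u v → F u v ≡ F v u) × (∀ v → count (F v) ≤ C)

Forbidden : ∀ {n C} → ValidFamily n C → Edge n → Set
Forbidden (F , _) (u , v) = F v u ≡ true

endpoints : ∀ {n} → List (Edge n) → List (Fin n)
endpoints = concatMap (λ { (u , v) → u ∷ v ∷ [] })

HasMatchingCovering : ∀ {n} → List (Edge n) → ℕ → Set
HasMatchingCovering {n} Cn k =
  Σ (List (Edge n)) λ M →
    All (λ { (u , v) → Claimed Cn u v }) M × Unique (endpoints M) × k ≤ 2 * length M

-- The game ends when the player to move has no legal
-- move.  WinB: Blocker to move and Constructor can force reaching the target.
-- WinC: Constructor to move (before the family F is presented).
mutual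
  data WinB {n : ℕ} (G : Graph n) (C k : ℕ) (B Cn : List (Edge n)) : Set where
    reachedB : HasMatchingCovering Cn k → WinB G C k B Cn
    blockerMoves :
      Σ (Edge n) (Avail G B Cn) →
      (∀ e → Avail G B Cn e → WinC G C k (e ∷ B) Cn) →
      WinB G C k B Cn

  data WinC {n : ℕ} (G : Graph n) (C k : ℕ) (B Cn : List (Edge n)) : Set where
    reachedC : HasMatchingCovering Cn k → WinC G C k B Cn
    constructorMoves :
      (∀ (F : ValidFamily n C) →
        HasMatchingCovering Cn k ⊎
        Σ (Edge n) λ e → Avail G B Cn e × ¬ Forbidden F e × WinB G C k B (e ∷ Cn)) →
      WinC G C k B Cn

ConstructorCanBuild : ∀ {n} → Graph n → ℕ → ℕ → Set
ConstructorCanBuild G C k = WinB G C k [] []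

{-# OPTIONS --safe #-}
-- Constructor keeps two invariants: his edges form a matching M, and every edge of
-- Blocker has an endpoint covered by M; together they guarantee that no edge between
-- two free vertices is claimed.  When Blocker claims ab, Constructor adds to M a permitted
-- non-edge xz of G between two free vertices such that ab then meets V(M): if ab
-- already does, any such pair works; otherwise x = a and z is a free vertex outside
-- {a, b} ∪ N_G(a) ∪ F_a, which exists while more than Δ + C + 2 vertices are free.
-- When Δ ≤ 1 and C = 0, three free vertices suffice: take any free z ∉ {a, b}; as z
-- has at most one neighbour in G, one of az and bz is a non-edge.
module Submission where

open import Defs
open import Data.Bool using (Bool; true; false; _∨_; not; if_then_else_)
open import Data.Bool.Properties using (¬-not; ∨-inverseʳ) renaming (_≟_ to _≟ᵇ_)
open import Data.Fin using (Fin; zero; suc)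
open import Data.Fin.Properties using (_≟_; any?)
open import Data.List using (List; []; _∷_; length)
open import Data.List.Properties using (map-tabulate)
import Data.List.Membership.DecPropositional as DecMembership
open import Data.List.Membership.Propositional using (_∈_; _∉_)
open import Data.List.Relation.Unary.Any using (here; there)
open import Data.List.Relation.Unary.All as All using (All; []; _∷_)
open import Data.List.Relation.Unary.All.Properties using (¬Any⇒All¬)
open import Data.List.Relation.Unary.AllPairs using ([]; _∷_)
open import Data.List.Relation.Unary.Unique.Propositional using (Unique)
open import Data.Nat using (ℕ; zero; suc; _+_; _*_; _∸_; _%_; _≤_; _<_; z≤n; s≤s; _≤?_)
open import Data.Nat.DivMod using (m*n%n≡0)
open import Data.Nat.ListAction using (sum)
open import Data.Nat.Properties hiding (_≟_)
open import Data.Product as Product using (∃; _×_; _,_; proj₁; proj₂)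
open import Data.Sum as Sum using (_⊎_; inj₁; inj₂)
open import Function using (_∘_; id)
open import Relation.Nullary using (¬_; Dec; does; yes; no; contradiction; _×-dec_)
open import Relation.Nullary.Decidable using (dec-true)
open import Relation.Binary.PropositionalEquality

open import Algebra.Properties.CommutativeSemigroup +-commutativeSemigroup using (interchange)

private
  variable
    n : ℕ

module _ {n : ℕ} where
  open DecMembership (_≟_ {n}) public using (_∈?_)

∨-false : ∀ {a b} → a ∨ b ≡ false → a ≡ false × b ≡ false
∨-false {false} {false} refl = refl , refl

does-false⇒¬ : ∀ {A : Set} (d : Dec A) → does d ≡ false → ¬ A
does-false⇒¬ d does≡false a = contradiction (trans (sym (dec-true d a)) does≡false) λ ()

count-suc : (f : Fin (suc n) → Bool) →
            count f ≡ (if f zero then 1 else 0) + count (f ∘ suc)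
count-suc f = cong ((if f zero then 1 else 0) +_) (cong sum
  (trans (map-tabulate suc (λ u → if f u then 1 else 0))
         (sym (map-tabulate id (λ u → if f (suc u) then 1 else 0)))))

count-const : (b : Bool) → count {n} (λ _ → b) ≡ (if b then n else 0)
count-const {zero}  false = refl
count-const {zero}  true  = refl
count-const {suc n} b = trans (count-suc {n} (λ _ → b)) (step b)
  where
  step : (b : Bool) → (if b then 1 else 0) + count {n} (λ _ → b) ≡ (if b then suc n else 0)
  step false = count-const {n} false
  step true  = cong suc (count-const {n} true)

count-mono : {f g : Fin n → Bool} → (∀ v → f v ≡ true → g v ≡ true) → count f ≤ count g
count-mono {zero}          f⇒g = z≤n
count-mono {suc n} {f} {g} f⇒g
  rewrite count-suc f | count-suc g =
  +-mono-≤ (head (f zero) (g zero) (f⇒g zero)) (count-mono (f⇒g ∘ suc))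
  where
  head : ∀ a b → (a ≡ true → b ≡ true) → (if a then 1 else 0) ≤ (if b then 1 else 0)
  head false _ _ = z≤n
  head true  b a⇒b rewrite a⇒b refl = ≤-refl

count-∨ : (f g : Fin n → Bool) → count (λ v → f v ∨ g v) ≤ count f + count g
count-∨ {zero}  f g = z≤n
count-∨ {suc n} f g
  rewrite count-suc (λ v → f v ∨ g v) | count-suc f | count-suc g =
  ≤-trans (+-mono-≤ (head (f zero) (g zero)) (count-∨ (f ∘ suc) (g ∘ suc)))
          (≤-reflexive (interchange (if f zero then 1 else 0) (if g zero then 1 else 0)
                                       (count (f ∘ suc)) (count (g ∘ suc))))
  where
  head : ∀ a b → (if a ∨ b then 1 else 0) ≤ (if a then 1 else 0) + (if b then 1 else 0)
  head false _ = ≤-refl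
  head true  _ = s≤s z≤n

count-∨-≤ : (f g : Fin n → Bool) {a b : ℕ} → count f ≤ a → count g ≤ b →
            count (λ v → f v ∨ g v) ≤ a + b
count-∨-≤ f g f≤a g≤b = ≤-trans (count-∨ f g) (+-mono-≤ f≤a g≤b)

count-≟ : (a : Fin n) → count (λ v → does (v ≟ a)) ≤ 1
count-≟ {suc n} zero =
  ≤-reflexive (trans (count-suc {n} (λ v → does (v ≟ zero))) (cong suc (count-const {n} false)))
count-≟ {suc n} (suc a)
  rewrite count-suc (λ v → does (v ≟ suc a)) = count-≟ a

count-∈ : (L : List (Fin n)) → count (λ v → does (v ∈? L)) ≤ length L
count-∈ {n} []      = ≤-reflexive (count-const {n} false)
count-∈ {n} (a ∷ L) =
  count-∨-≤ (λ v → does (v ≟ a)) (λ v → does (v ∈? L)) (count-≟ a) (count-∈ L)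

count-cover : (f g : Fin n → Bool) → (∀ v → f v ∨ g v ≡ true) → n ≤ count f + count g
count-cover {n} f g cover = begin
  n                            ≡⟨ count-const {n} true ⟨
  count {n} (λ _ → true)       ≤⟨ count-mono (λ v _ → cover v) ⟩
  count (λ v → f v ∨ g v)      ≤⟨ count-∨ f g ⟩
  count f + count g            ∎
  where open ≤-Reasoning

true⇒1≤count : (f : Fin n → Bool) {a : Fin n} → f a ≡ true → 1 ≤ count f
true⇒1≤count {suc n} f {zero} fa rewrite count-suc f | fa = s≤s z≤n
true⇒1≤count {suc n} f {suc a} fa rewrite count-suc f =
  ≤-trans (true⇒1≤count (f ∘ suc) fa) (m≤n+m _ _)

true²⇒2≤count : (f : Fin n → Bool) {a b : Fin n} → a ≢ b → f a ≡ true → f b ≡ true →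
                2 ≤ count f
true²⇒2≤count {suc n} f {zero}  {zero}  a≢b _  _  = contradiction refl a≢b
true²⇒2≤count {suc n} f {zero}  {suc b} _   fa fb
  rewrite count-suc f | fa = s≤s (true⇒1≤count (f ∘ suc) fb)
true²⇒2≤count {suc n} f {suc a} {zero}  _   fa fb
  rewrite count-suc f | fb = s≤s (true⇒1≤count (f ∘ suc) fa)
true²⇒2≤count {suc n} f {suc a} {suc b} a≢b fa fb rewrite count-suc f =
  ≤-trans (true²⇒2≤count (f ∘ suc) (a≢b ∘ cong suc) fa fb) (m≤n+m _ _)

pigeonhole : (good bad : Fin n → Bool) → count bad < count good →
             ∃ λ z → good z ≡ true × bad z ≡ false
pigeonhole good bad bad<good
  with any? (λ z → (good z ≟ᵇ true) ×-dec (bad z ≟ᵇ false))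
... | yes found = found
... | no  none  = contradiction
  (count-mono (λ z good-z → ¬-not (λ bad-z → none (z , good-z , bad-z))))
  (<⇒≱ bad<good)

free : List (Edge n) → Fin n → Bool
free M v = not (does (v ∈? endpoints M))

free⇒∉ : (M : List (Edge n)) {v : Fin n} → free M v ≡ true → v ∉ endpoints M
free⇒∉ M {v} v-free v∈M =
  contradiction (trans (sym v-free) (cong not (dec-true (v ∈? endpoints M) v∈M))) λ ()

length-endpoints : (M : List (Edge n)) → length (endpoints M) ≡ 2 * length M
length-endpoints []      = refl
length-endpoints (e ∷ M) = begin
  2 + length (endpoints M)  ≡⟨ cong (2 +_) (length-endpoints M) ⟩
  2 + 2 * length M          ≡⟨ *-suc 2 (length M) ⟨
  2 * suc (length M)        ∎
  where open ≡-Reasoning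

count-free : (M : List (Edge n)) → n ∸ 2 * length M ≤ count (free M)
count-free {n} M = m≤n+o⇒m∸n≤o n (2 * length M) (begin
  n                                                ≤⟨ count-cover covered (free M) (λ v → ∨-inverseʳ (covered v)) ⟩
  count covered + count (free M)                   ≤⟨ +-monoˡ-≤ _ (count-∈ (endpoints M)) ⟩
  length (endpoints M) + count (free M)            ≡⟨ cong (_+ count (free M)) (length-endpoints M) ⟩
  2 * length M + count (free M)                    ∎)
  where
  open ≤-Reasoning
  covered : Fin n → Bool
  covered v = does (v ∈? endpoints M)

∈⇒∈-endpoints : {M : List (Edge n)} {u v : Fin n} → (u , v) ∈ M →
                u ∈ endpoints M × v ∈ endpoints M
∈⇒∈-endpoints             (here refl) = here refl , there (here refl)
∈⇒∈-endpoints {M = _ ∷ _} (there uv∈M) =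
  Product.map (there ∘ there) (there ∘ there) (∈⇒∈-endpoints uv∈M)

Meets : List (Fin n) → Edge n → Set
Meets S (a , b) = a ∈ S ⊎ b ∈ S

Touches : List (Edge n) → List (Edge n) → Set
Touches M B = All (Meets (endpoints M)) B

∉⇒unclaimed : (M : List (Edge n)) {x z : Fin n} → x ∉ endpoints M → ¬ Claimed M x z
∉⇒unclaimed M x∉M (inj₁ xz∈M) = x∉M (proj₁ (∈⇒∈-endpoints xz∈M))
∉⇒unclaimed M x∉M (inj₂ zx∈M) = x∉M (proj₂ (∈⇒∈-endpoints zx∈M))

meets⇒≢ : {S : List (Fin n)} {a b x z : Fin n} → Meets S (a , b) → x ∉ S → z ∉ S →
          (x , z) ≢ (a , b)
meets⇒≢ (inj₁ a∈S) x∉S _   refl = x∉S a∈S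
meets⇒≢ (inj₂ b∈S) _   z∉S refl = z∉S b∈S

touched⇒unclaimed : (M : List (Edge n)) {B : List (Edge n)} {x z : Fin n} → Touches M B →
                    x ∉ endpoints M → z ∉ endpoints M → ¬ Claimed B x z
touched⇒unclaimed M touch x∉M z∉M (inj₁ xz∈B) = meets⇒≢ (All.lookup touch xz∈B) x∉M z∉M refl
touched⇒unclaimed M touch x∉M z∉M (inj₂ zx∈B) = meets⇒≢ (All.lookup touch zx∈B) z∉M x∉M refl

unclaimed-∷ : {B : List (Edge n)} {e : Edge n} {x z : Fin n} →
              (x , z) ≢ e → (z , x) ≢ e → ¬ Claimed B x z → ¬ Claimed (e ∷ B) x z
unclaimed-∷ xz≢e _    _         (inj₁ (here xz≡e))  = xz≢e xz≡e
unclaimed-∷ _    zx≢e _         (inj₂ (here zx≡e))  = zx≢e zx≡e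
unclaimed-∷ _    _    unclaimed (inj₁ (there xz∈B)) = unclaimed (inj₁ xz∈B)
unclaimed-∷ _    _    unclaimed (inj₂ (there zx∈B)) = unclaimed (inj₂ zx∈B)

matching-∷ : (M : List (Edge n)) {x z : Fin n} → Unique (endpoints M) →
             x ∉ endpoints M → z ∉ endpoints M → x ≢ z → Unique (endpoints ((x , z) ∷ M))
matching-∷ M matching x∉M z∉M x≢z =
  (x≢z ∷ ¬Any⇒All¬ (endpoints M) x∉M) ∷ ¬Any⇒All¬ (endpoints M) z∉M ∷ matching

touches-∷ : (M : List (Edge n)) {B : List (Edge n)} {a b x z : Fin n} → Touches M B →
            Meets (x ∷ z ∷ endpoints M) (a , b) → Touches ((x , z) ∷ M) ((a , b) ∷ B)
touches-∷ M touch meets = meets ∷ All.map (Sum.map (there ∘ there) (there ∘ there)) touch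

m<n∸o⇒o<n∸m : {m n o : ℕ} → m < n ∸ o → o < n ∸ m
m<n∸o⇒o<n∸m {m} {n} {o} m<n∸o = m+n≤o⇒m≤o∸n (suc o) (begin
  suc o + m   ≡⟨ cong suc (+-comm o m) ⟩
  suc m + o   ≤⟨ m≤o∸n⇒m+n≤o (suc m) (<⇒≤ o<n) m<n∸o ⟩
  n           ∎)
  where
  open ≤-Reasoning
  o<n : o < n
  o<n = m∸n≢0⇒n<m λ n∸o≡0 → n≮0 (subst (m <_) n∸o≡0 m<n∸o)

module Strategy {n : ℕ} (G : Graph n) (G-sym : ∀ u v → G u v ≡ G v u)
                (Δ : ℕ) (G-deg : MaxDeg≤ G Δ) (C : ℕ) where

  Sparse : Set
  Sparse = Δ ≤ 1 × C ≡ 0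

  EnoughFree : ℕ → Set
  EnoughFree u = 3 + (Δ + C) ≤ u ⊎ (Sparse × 3 ≤ u)

  enough-free-mono : {u v : ℕ} → EnoughFree u → u ≤ v → EnoughFree v
  enough-free-mono (inj₁ room)            u≤v = inj₁ (≤-trans room u≤v)
  enough-free-mono (inj₂ (sparse , room)) u≤v = inj₂ (sparse , ≤-trans room u≤v)

  enough-free⇒2+Δ+C≤ : {u : ℕ} → EnoughFree u → 2 + (Δ + C) ≤ u
  enough-free⇒2+Δ+C≤ (inj₁ room)                 = ≤-trans (n≤1+n _) room
  enough-free⇒2+Δ+C≤ (inj₂ ((Δ≤1 , refl) , room)) =
    ≤-trans (+-monoʳ-≤ 2 (≤-trans (≤-reflexive (+-identityʳ Δ)) Δ≤1)) room

  empty-family : ValidFamily n C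
  empty-family = (λ _ _ → false) , (λ _ _ → refl) ,
                (λ _ → ≤-trans (≤-reflexive (count-const {n} false)) z≤n)

  record FreePair (M : List (Edge n)) (F : ValidFamily n C) : Set where
    field
      x z       : Fin n
      x-free    : x ∉ endpoints M
      z-free    : z ∉ endpoints M
      x≢z       : x ≢ z
      non-edge  : G x z ≡ false
      permitted : ¬ Forbidden F (x , z)

  partner : (M : List (Edge n)) (F : ValidFamily n C) (x : Fin n) (avoid : Fin n → Bool)
            {m : ℕ} → count avoid ≤ m → 2 + (m + (Δ + C)) ≤ count (free M) →
            ∃ λ z → z ∉ endpoints M × avoid z ≡ false × z ≢ x ×
                    G x z ≡ false × ¬ Forbidden F (x , z)
  partner M (F , F-sym , F-bound) x avoid {m} avoid≤m room =
    let z , z-free , bad-z = pigeonhole (free M) bad (≤-trans (s≤s bad≤) room)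
        z≟x , bad-z′       = ∨-false bad-z
        avoid-z , bad-z″   = ∨-false bad-z′
        Gxz , Fxz          = ∨-false bad-z″
    in z , free⇒∉ M z-free , avoid-z , does-false⇒¬ (z ≟ x) z≟x , Gxz ,
       λ Fzx → contradiction (trans (sym Fzx) (trans (F-sym z x) Fxz)) λ ()
    where
    bad : Fin n → Bool
    bad z = does (z ≟ x) ∨ avoid z ∨ G x z ∨ F x z
    bad≤ : count bad ≤ 1 + (m + (Δ + C))
    bad≤ = count-∨-≤ (λ z → does (z ≟ x)) _ (count-≟ x)
             (count-∨-≤ avoid _ avoid≤m (count-∨-≤ (G x) (F x) (G-deg x) (F-bound x)))

  free-pair : (M : List (Edge n)) (F : ValidFamily n C) → 2 + (Δ + C) ≤ count (free M) →
              FreePair M F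
  free-pair M F room =
    let x , x-free , _                        = pigeonhole (free M) (λ _ → false) some-free
        z , z-free , _ , z≢x , Gxz , permitted = partner M F x (λ _ → false) nothing≤0 room
    in record { x = x ; z = z ; x-free = free⇒∉ M x-free ; z-free = z-free
              ; x≢z = z≢x ∘ sym ; non-edge = Gxz ; permitted = permitted }
    where
    nothing≤0 : count {n} (λ _ → false) ≤ 0
    nothing≤0 = ≤-reflexive (count-const {n} false)
    some-free : count {n} (λ _ → false) < count (free M)
    some-free = ≤-trans (s≤s nothing≤0) (≤-trans (s≤s z≤n) room)

  record Reply (M : List (Edge n)) (F : ValidFamily n C) (a b : Fin n) : Set where
    field
      pair : FreePair M F
    open FreePair pair public
    field
      xz≢ab : (x , z) ≢ (a , b)
      zx≢ab : (z , x) ≢ (a , b)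
      meets : Meets (x ∷ z ∷ endpoints M) (a , b)

  reply-to-covered : {M : List (Edge n)} {F : ValidFamily n C} {a b : Fin n} →
                  Meets (endpoints M) (a , b) → FreePair M F → Reply M F a b
  reply-to-covered ab-meets p = record
    { pair = p
    ; xz≢ab = meets⇒≢ ab-meets x-free z-free
    ; zx≢ab = meets⇒≢ ab-meets z-free x-free
    ; meets = Sum.map (there ∘ there) (there ∘ there) ab-meets }
    where open FreePair p

  reply-from-endpoint : {M : List (Edge n)} {F : ValidFamily n C} {a b : Fin n} (p : FreePair M F) →
                  let open FreePair p in
                  z ≢ a → z ≢ b → x ≡ a ⊎ x ≡ b → Reply M F a b
  reply-from-endpoint p z≢a z≢b x∈ab = record
    { pair = p
    ; xz≢ab = λ { refl → z≢b refl }
    ; zx≢ab = λ { refl → z≢a refl }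
    ; meets = Sum.map (here ∘ sym) (here ∘ sym) x∈ab }

  reply-to-uncovered : (M : List (Edge n)) (F : ValidFamily n C) {a b : Fin n} →
                3 + (Δ + C) ≤ count (free M) → a ∉ endpoints M → Reply M F a b
  reply-to-uncovered M F {a} {b} room a∉M =
    let z , z-free , z≟b , z≢a , Gaz , permitted =
          partner M F a (λ v → does (v ≟ b)) (count-≟ b) room
    in reply-from-endpoint
         (record { x = a ; z = z ; x-free = a∉M ; z-free = z-free
                 ; x≢z = z≢a ∘ sym ; non-edge = Gaz ; permitted = permitted })
         z≢a (does-false⇒¬ (z ≟ b) z≟b) (inj₁ refl)

  no-forbidden : C ≡ 0 → (F : ValidFamily n C) (e : Edge n) → ¬ Forbidden F e
  no-forbidden refl (F , _ , F-bound) (x , z) Fzx =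
    contradiction (≤-trans (true⇒1≤count (F z) Fzx) (F-bound z)) λ ()

  sole-neighbour : Δ ≤ 1 → {a b z : Fin n} → a ≢ b → G a z ≡ true → G b z ≡ false
  sole-neighbour Δ≤1 {a} {b} {z} a≢b Gaz with G b z in Gbz
  ... | false = refl
  ... | true  = contradiction
    (≤-trans (true²⇒2≤count (G z) a≢b (trans (G-sym z a) Gaz) (trans (G-sym z b) Gbz))
             (≤-trans (G-deg z) Δ≤1))
    λ { (s≤s ()) }

  sparse-reply-through : {M : List (Edge n)} (F : ValidFamily n C) {a b z : Fin n} → Sparse →
                 a ∉ endpoints M → b ∉ endpoints M → a ≢ b →
                 z ∉ endpoints M → z ≢ a → z ≢ b → Reply M F a b
  sparse-reply-through F {a} {b} {z} (Δ≤1 , C≡0) a∉M b∉M a≢b z∉M z≢a z≢b with G a z in Gaz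
  ... | false = reply-from-endpoint
    (record { x = a ; z = z ; x-free = a∉M ; z-free = z∉M ; x≢z = z≢a ∘ sym
            ; non-edge = Gaz ; permitted = no-forbidden C≡0 F (a , z) })
    z≢a z≢b (inj₁ refl)
  ... | true = reply-from-endpoint
    (record { x = b ; z = z ; x-free = b∉M ; z-free = z∉M ; x≢z = z≢b ∘ sym
            ; non-edge = sole-neighbour Δ≤1 a≢b Gaz ; permitted = no-forbidden C≡0 F (b , z) })
    z≢a z≢b (inj₂ refl)

  reply-to-uncovered-sparse : (M : List (Edge n)) (F : ValidFamily n C) {a b : Fin n} →
                       Sparse → 3 ≤ count (free M) →
                       a ∉ endpoints M → b ∉ endpoints M → a ≢ b → Reply M F a b
  reply-to-uncovered-sparse M F {a} {b} sparse room a∉M b∉M a≢b =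
    let z , z-free , bad-z = pigeonhole (free M) (λ z → does (z ≟ a) ∨ does (z ≟ b))
                                          (≤-trans (s≤s bad≤2) room)
        z≟a , z≟b          = ∨-false bad-z
    in sparse-reply-through F sparse a∉M b∉M a≢b (free⇒∉ M z-free)
         (does-false⇒¬ (z ≟ a) z≟a) (does-false⇒¬ (z ≟ b) z≟b)
    where
    bad≤2 : count (λ z → does (z ≟ a) ∨ does (z ≟ b)) ≤ 2
    bad≤2 = count-∨-≤ (λ z → does (z ≟ a)) (λ z → does (z ≟ b)) (count-≟ a) (count-≟ b)

  reply : (M : List (Edge n)) (F : ValidFamily n C) {a b : Fin n} → a ≢ b →
          EnoughFree (count (free M)) → Reply M F a b
  reply M F {a} {b} a≢b enough-free
    with a ∈? endpoints M | b ∈? endpoints M | enough-free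
  ... | yes a∈M | _       | _ = reply-to-covered (inj₁ a∈M) (free-pair M F (enough-free⇒2+Δ+C≤ enough-free))
  ... | no _    | yes b∈M | _ = reply-to-covered (inj₂ b∈M) (free-pair M F (enough-free⇒2+Δ+C≤ enough-free))
  ... | no a∉M  | no _    | inj₁ room            = reply-to-uncovered M F room a∉M
  ... | no a∉M  | no b∉M  | inj₂ (sparse , room) = reply-to-uncovered-sparse M F sparse room a∉M b∉M a≢b

  module _ (k : ℕ) (enough : ∀ L → 2 * L < k → EnoughFree (n ∸ 2 * L)) where

    play : (m : ℕ) (B M : List (Edge n)) → Unique (endpoints M) → Touches M B →
           k ≤ 2 * (m + length M) → WinB G C k B M
    play m B M matching touch fuel with k ≤? 2 * length M
    ... | yes reached = reachedB (M , All.tabulate inj₁ , matching , reached)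
    play zero    B M matching touch k≤2L | no unreached = contradiction k≤2L unreached
    play (suc m) B M matching touch fuel | no unreached =
      blockerMoves blocker-move constructor-reply
      where
      enough-free : EnoughFree (count (free M))
      enough-free = enough-free-mono (enough (length M) (≰⇒> unreached)) (count-free M)

      blocker-move : ∃ (Avail G B M)
      blocker-move = (x , z) , x≢z , non-edge ,
                     touched⇒unclaimed M touch x-free z-free , ∉⇒unclaimed M x-free
        where open FreePair (free-pair M empty-family (enough-free⇒2+Δ+C≤ enough-free))

      constructor-reply : ∀ e → Avail G B M e → WinC G C k (e ∷ B) M
      constructor-reply (a , b) (a≢b , _) = constructorMoves λ F →
        let open Reply (reply M F a≢b enough-free) in
        inj₂ ((x , z) ,
              (x≢z , non-edge ,
               unclaimed-∷ xz≢ab zx≢ab (touched⇒unclaimed M touch x-free z-free) ,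
               ∉⇒unclaimed M x-free) ,
              permitted ,
              play m ((a , b) ∷ B) ((x , z) ∷ M) (matching-∷ M matching x-free z-free x≢z)
                   (touches-∷ M touch meets) (subst (λ r → k ≤ 2 * r) (sym (+-suc m (length M))) fuel))

    constructor-wins : ConstructorCanBuild G C k
    constructor-wins = play k [] [] [] [] (≤-trans (m≤m+n k 0) (m≤n*m (k + 0) 2))

remaining-general : (n Δ C L : ℕ) → 2 * L < n ∸ Δ ∸ 2 ∸ C → 3 + (Δ + C) ≤ n ∸ 2 * L
remaining-general n Δ C L 2L<k = subst (_< n ∸ 2 * L) Δ+[2+C]≡2+[Δ+C]
  (m<n∸o⇒o<n∸m (subst (2 * L <_) (trans (∸-+-assoc (n ∸ Δ) 2 C) (∸-+-assoc n Δ (2 + C))) 2L<k))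
  where
  Δ+[2+C]≡2+[Δ+C] : Δ + (2 + C) ≡ 2 + (Δ + C)
  Δ+[2+C]≡2+[Δ+C] = trans (+-suc Δ (suc C)) (cong suc (+-suc Δ C))

remaining-even : (n L : ℕ) → 2 * L < n ∸ 2 → 3 ≤ n ∸ 2 * L
remaining-even n L = m<n∸o⇒o<n∸m

remaining-odd : (n L : ℕ) → n % 2 ≡ 1 → 2 * L < n ∸ 1 → 3 ≤ n ∸ 2 * L
remaining-odd n L odd 2L<n∸1 = ≤∧≢⇒< (m<n∸o⇒o<n∸m 2L<n∸1) λ 2≡n∸2L →
  contradiction (trans (sym odd) (trans (cong (_% 2) (n≡[1+L]*2 2≡n∸2L)) (m*n%n≡0 (suc L) 2))) λ ()
  where
  n≡[1+L]*2 : 2 ≡ n ∸ 2 * L → n ≡ suc L * 2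
  n≡[1+L]*2 2≡n∸2L = begin
    n                  ≡⟨ m∸n+n≡m (≤-trans (<⇒≤ 2L<n∸1) (m∸n≤m n 1)) ⟨
    n ∸ 2 * L + 2 * L  ≡⟨ cong (_+ 2 * L) 2≡n∸2L ⟨
    2 + 2 * L          ≡⟨ *-suc 2 L ⟨
    2 * suc L          ≡⟨ *-comm 2 (suc L) ⟩
    suc L * 2          ∎
    where open ≡-Reasoning

lemma2p5 : (n Δ C : ℕ) (G : Graph n) → Simple G → MaxDeg≤ G Δ →
    ConstructorCanBuild G C (n ∸ Δ ∸ 2 ∸ C)
    × (Δ ≤ 1 → C ≡ 0 →
        (n % 2 ≡ 1 → ConstructorCanBuild G C (n ∸ 1))
        × (n % 2 ≡ 0 → ConstructorCanBuild G C (n ∸ 2)))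
lemma2p5 n Δ C G (G-sym , _) G-deg =
  constructor-wins (n ∸ Δ ∸ 2 ∸ C) (λ L → inj₁ ∘ remaining-general n Δ C L) ,
  λ Δ≤1 C≡0 →
    (λ odd → constructor-wins (n ∸ 1) (λ L → inj₂ ∘ ((Δ≤1 , C≡0) ,_) ∘ remaining-odd n L odd)) ,
    (λ _   → constructor-wins (n ∸ 2) (λ L → inj₂ ∘ ((Δ≤1 , C≡0) ,_) ∘ remaining-even n L))
  where open Strategy G G-sym Δ G-deg C
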